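{- For every integer $k \ge 2$, the complete bipartite graph $K_{2^k,2^k}$ has a proper edge-coloring with no rainbow path with $2^k$ edges. Consequently, for every $n$, $ex^{*}(n, P_{2^k}) \ge (2^k)^2 \left\lfloor \frac{n}{2^{k+1}} \right\rfloor$.
   Context: $P_m$ denotes a path with $m$ edges. An edge-colored graph is rainbow if all its edges have different colors. For a graph $F$, $ex^{*}(n,F)$ is the maximum number of edges in a graph on $n$ vertices that has a proper edge-coloring containing no rainbow copy of $F$. -}

module Defs where

open import Data.Nat using (ℕ; zero; suc; _+_; _*_; _^_; _≤_; _<ᵇ_)
open import Data.Nat.DivMod using (_/_)
open import Data.Bool using (Bool; true; false; _∧_; _xor_; if_then_else_)
open import Data.Fin using (Fin; toℕ; inject₁) renaming (suc to fsuc)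
open import Data.List using (List; map; allFin)
open import Data.Nat.ListAction using (sum)
open import Data.Product using (Σ; _×_; ∃-syntax)
open import Relation.Binary.PropositionalEquality using (_≡_; _≢_)
open import Relation.Nullary using (¬_)
open import Function.Definitions using (Injective)

record Graph (n : ℕ) : Set where
  field
    adj    : Fin n → Fin n → Bool
    sym    : ∀ i j → adj i j ≡ adj j i
    irrefl : ∀ i → adj i i ≡ false
open Graph public

Edge : ∀ {n} → Graph n → Fin n → Fin n → Set
Edge G i j = adj G i j ≡ true

edgeCount : ∀ {n} → Graph n → ℕ
edgeCount {n} G =
  sum (map (λ i → sum (map (λ j → if adj G i j ∧ (toℕ i <ᵇ toℕ j) then 1 else 0)
                           (allFin n)))
           (allFin n))

-- An edge-colouring assigns a colour (a natural number) to every pair;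
-- only the values on edges matter, and it must be symmetric on edges.
EdgeColoring : ℕ → Set
EdgeColoring n = Fin n → Fin n → ℕ

IsProperColoring : ∀ {n} → Graph n → EdgeColoring n → Set
IsProperColoring {n} G c =
  (∀ i j → Edge G i j → c i j ≡ c j i) ×
  (∀ u v w → Edge G u v → Edge G u w → v ≢ w → c u v ≢ c u w)

record PathCopy {n : ℕ} (G : Graph n) (m : ℕ) : Set where
  field
    vtx      : Fin (suc m) → Fin n
    distinct : Injective _≡_ _≡_ vtx
    edges    : ∀ (i : Fin m) → Edge G (vtx (inject₁ i)) (vtx (fsuc i))
open PathCopy public

pathEdgeColor : ∀ {n m} {G : Graph n} → EdgeColoring n → PathCopy G m → Fin m → ℕ
pathEdgeColor c P i = c (vtx P (inject₁ i)) (vtx P (fsuc i))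

IsRainbow : ∀ {n m} {G : Graph n} → EdgeColoring n → PathCopy G m → Set
IsRainbow {m = m} c P = ∀ (i j : Fin m) → i ≢ j → pathEdgeColor c P i ≢ pathEdgeColor c P j

NoRainbowPath : ∀ {n} (G : Graph n) → EdgeColoring n → ℕ → Set
NoRainbowPath G c m = ¬ (Σ (PathCopy G m) (IsRainbow c))

-- complete bipartite graph K_{a,b} on Fin (a + b): parts {0..a-1} and {a..a+b-1}
completeBipartite : (a b : ℕ) → Graph (a + b)
completeBipartite a b = record
  { adj = λ i j → (toℕ i <ᵇ a) xor (toℕ j <ᵇ a)
  ; sym = λ i j → xor-comm (toℕ i <ᵇ a) (toℕ j <ᵇ a)
  ; irrefl = λ i → xor-self (toℕ i <ᵇ a)
  }
  where
  xor-comm : ∀ x y → (x xor y) ≡ (y xor x)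
  xor-comm true true = _≡_.refl
  xor-comm true false = _≡_.refl
  xor-comm false true = _≡_.refl
  xor-comm false false = _≡_.refl
  xor-self : ∀ x → (x xor x) ≡ false
  xor-self true = _≡_.refl
  xor-self false = _≡_.refl

-- "ex*(n, P_m) ≥ N": some graph on n vertices with at least N edges has a
-- proper edge-colouring with no rainbow P_m (ex* is a maximum over such graphs)
exStarPathAtLeast : (n m N : ℕ) → Set
exStarPathAtLeast n m N =
  ∃[ G ] (N ≤ edgeCount {n} G × ∃[ c ] (IsProperColoring G c × NoRainbowPath G c m))

module Submission where

-- Let P = 2ᵏ.  Label a vertex x by the k binary digits of x mod P, a vector
-- of 𝔽₂ᵏ, and colour an edge by the xor of the labels of its ends.  Suppose
-- every edge joins a block {bP, …, bP + P - 1} to its partner block (b xor 1),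
-- as in K_{P,P} on the blocks 0 and 1, or in q disjoint copies of it.  Then:
--  * the colouring is proper: neighbours of u all lie in one block and have
--    distinct labels, as their colours differ;
--  * there is no rainbow path with P edges: such a path uses each of the P
--    colours once, so its edge labels sum to the sum of all of 𝔽₂ᵏ, which is
--    0 for k ≥ 2; the sum telescopes, so the ends have equal labels; the path
--    alternates between two partner blocks and has even length, so the ends
--    lie in the same block; hence they coincide, which a path forbids.
-- Taking ⌊n / 2P⌋ disjoint copies of K_{P,P} inside n vertices gives the
-- lower bound on ex*(n, P_{2ᵏ}).

open import Defs hiding (sym)  -- the Graph field sym would clash with symmetry of ≡
open import Data.Nat using (ℕ; _≤_; _*_; _^_; _+_)
open import Data.Nat.DivMod using (_/_)
open import Data.Product using (_×_; ∃-syntax)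
open import Data.Nat.Properties using (m^n≢0)

open import Algebra.Bundles using (CommutativeMonoid)
import Algebra.Properties.CommutativeMonoid.Sum as CommutativeMonoidSum
open import Data.Bool using (Bool; true; false; T; _xor_; _∧_; if_then_else_)
open import Data.Bool.Properties using (xor-assoc; xor-comm; xor-identityˡ; xor-identityʳ; xor-same; T-∧; T-≡)
open import Data.Empty using (⊥-elim)
open import Data.Fin as Fin using (Fin; toℕ; fromℕ<; fromℕ; inject₁)
open import Data.Fin.Permutation using (Permutation; permutation)
open import Data.Fin.Properties using (toℕ-injective; toℕ-fromℕ; toℕ-fromℕ<; toℕ<n; any?; punchOut-injective; injective⇒≤)
open import Data.List using (map; allFin; tabulate)
open import Data.List.Properties using (map-tabulate)
open import Data.Nat using (zero; suc; pred; NonZero; _∸_; _<_; _<ᵇ_; _≡ᵇ_; z≤n; s≤s; z<s; s<s; ⌊_/2⌋)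
open import Data.Nat.DivMod using (_%_; m≡m%n+[m/n]*n; m%n<n; m/n*n≤m; +-distrib-/-∣ˡ; m*n/n≡m; m<n⇒m/n≡0; m/n≡1+[m∸n]/n)
open import Data.Nat.Divisibility using (n∣m*n)
open import Data.Nat.ListAction using () renaming (sum to listSum)
open import Data.Nat.Properties
  using ( m^n>0; suc-injective; 1+n≰n; <-irrefl; ≤-trans; ≮⇒≥; <ᵇ⇒<; <⇒<ᵇ; ≡ᵇ⇒≡; ≡⇒≡ᵇ; <ᵇ-reflects-<
        ; +-suc; +-assoc; +-comm; +-identityʳ; *-identityʳ; *-comm; *-distribˡ-+; *-distribʳ-+
        ; m≤m+n; m≤n+m; m+[n∸m]≡n; m<n+o⇒m∸n<o; +-mono-≤; +-monoʳ-<; *-monoˡ-≤; module ≤-Reasoning )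
open import Data.Product using (_,_; ∃; proj₁; proj₂)
open import Data.Unit using (tt)
open import Data.Vec using (Vec; []; _∷_; zipWith; replicate)
open import Data.Vec.Properties using (zipWith-assoc; zipWith-comm; zipWith-identityˡ; zipWith-identityʳ)
open import Function using (_∘_; id; Equivalence)
open import Function.Definitions using (Injective)
open import Level using (0ℓ)
open import Relation.Binary.PropositionalEquality
open import Relation.Nullary using (yes; no; contradiction)
open import Relation.Nullary.Reflects using (ofʸ; ofⁿ)

BitVec : ℕ → Set
BitVec = Vec Bool

infixl 6 _⊕_
_⊕_ : ∀ {k} → BitVec k → BitVec k → BitVec k
_⊕_ = zipWith _xor_

𝟎 : ∀ {k} → BitVec k
𝟎 = replicate _ false

⊕-assoc : ∀ {k} (u v w : BitVec k) → u ⊕ v ⊕ w ≡ u ⊕ (v ⊕ w)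
⊕-assoc = zipWith-assoc xor-assoc

⊕-comm : ∀ {k} (u v : BitVec k) → u ⊕ v ≡ v ⊕ u
⊕-comm = zipWith-comm xor-comm

⊕-identityˡ : ∀ {k} (v : BitVec k) → 𝟎 ⊕ v ≡ v
⊕-identityˡ = zipWith-identityˡ xor-identityˡ

⊕-identityʳ : ∀ {k} (v : BitVec k) → v ⊕ 𝟎 ≡ v
⊕-identityʳ = zipWith-identityʳ xor-identityʳ

⊕-self : ∀ {k} (v : BitVec k) → v ⊕ v ≡ 𝟎
⊕-self [] = refl
⊕-self (b ∷ v) = cong₂ _∷_ (xor-same b) (⊕-self v)

⊕-cancelˡ : ∀ {k} (u v w : BitVec k) → u ⊕ v ≡ u ⊕ w → v ≡ w
⊕-cancelˡ u v w eq = begin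
  v             ≡⟨ sym (⊕-identityˡ v) ⟩
  𝟎 ⊕ v         ≡⟨ cong (_⊕ v) (sym (⊕-self u)) ⟩
  u ⊕ u ⊕ v     ≡⟨ ⊕-assoc u u v ⟩
  u ⊕ (u ⊕ v)   ≡⟨ cong (u ⊕_) eq ⟩
  u ⊕ (u ⊕ w)   ≡⟨ sym (⊕-assoc u u w) ⟩
  u ⊕ u ⊕ w     ≡⟨ cong (_⊕ w) (⊕-self u) ⟩
  𝟎 ⊕ w         ≡⟨ ⊕-identityˡ w ⟩
  w             ∎
  where open ≡-Reasoning

⊕-telescope : ∀ {k} (a b c : BitVec k) → a ⊕ b ⊕ (b ⊕ c) ≡ a ⊕ c
⊕-telescope a b c = begin
  a ⊕ b ⊕ (b ⊕ c)   ≡⟨ ⊕-assoc a b (b ⊕ c) ⟩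
  a ⊕ (b ⊕ (b ⊕ c)) ≡⟨ cong (a ⊕_) (sym (⊕-assoc b b c)) ⟩
  a ⊕ (b ⊕ b ⊕ c)   ≡⟨ cong (λ x → a ⊕ (x ⊕ c)) (⊕-self b) ⟩
  a ⊕ (𝟎 ⊕ c)       ≡⟨ cong (a ⊕_) (⊕-identityˡ c) ⟩
  a ⊕ c             ∎
  where open ≡-Reasoning

⊕≡𝟎⇒≡ : ∀ {k} (u v : BitVec k) → u ⊕ v ≡ 𝟎 → u ≡ v
⊕≡𝟎⇒≡ u v u⊕v≡𝟎 = ⊕-cancelˡ u u v (trans (⊕-self u) (sym u⊕v≡𝟎))

⊕-commutativeMonoid : ℕ → CommutativeMonoid 0ℓ 0ℓ
⊕-commutativeMonoid k = record
  { Carrier = BitVec k ; _≈_ = _≡_ ; _∙_ = _⊕_ ; ε = 𝟎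
  ; isCommutativeMonoid = record
    { isMonoid = record
      { isSemigroup = record
        { isMagma = record { isEquivalence = isEquivalence ; ∙-cong = cong₂ _⊕_ }
        ; assoc = ⊕-assoc }
      ; identity = ⊕-identityˡ , ⊕-identityʳ }
    ; comm = ⊕-comm } }

module BitSum {k : ℕ} = CommutativeMonoidSum (⊕-commutativeMonoid k)
open BitSum using (∑-permute; sum-cong-≗; sum-replicate-zero) renaming (sum to ⨁)

odd : ℕ → Bool
odd zero = false
odd (suc zero) = true
odd (suc (suc n)) = odd n

double : ℕ → ℕ
double zero = zero
double (suc n) = suc (suc (double n))

bit : Bool → ℕ
bit false = 0
bit true = 1

double≡+ : ∀ n → double n ≡ n + n
double≡+ zero = refl
double≡+ (suc n) = cong suc (trans (cong suc (double≡+ n)) (sym (+-suc n n)))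

2^suc≡double : ∀ k → 2 ^ suc k ≡ double (2 ^ k)
2^suc≡double k = trans (cong (2 ^ k +_) (+-identityʳ (2 ^ k))) (sym (double≡+ (2 ^ k)))

digit-decomposition : ∀ n → bit (odd n) + double ⌊ n /2⌋ ≡ n
digit-decomposition zero = refl
digit-decomposition (suc zero) = refl
digit-decomposition (suc (suc n)) = begin
  bit (odd n) + suc (suc (double ⌊ n /2⌋)) ≡⟨ +-suc (bit (odd n)) _ ⟩
  suc (bit (odd n) + suc (double ⌊ n /2⌋)) ≡⟨ cong suc (+-suc (bit (odd n)) _) ⟩
  suc (suc (bit (odd n) + double ⌊ n /2⌋)) ≡⟨ cong (suc ∘ suc) (digit-decomposition n) ⟩
  suc (suc n)                               ∎
  where open ≡-Reasoning

odd-double : ∀ n → odd (double n) ≡ false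
odd-double zero = refl
odd-double (suc n) = odd-double n

odd-1+double : ∀ n → odd (suc (double n)) ≡ true
odd-1+double zero = refl
odd-1+double (suc n) = odd-1+double n

half-double : ∀ n → ⌊ double n /2⌋ ≡ n
half-double zero = refl
half-double (suc n) = cong suc (half-double n)

half-1+double : ∀ n → ⌊ suc (double n) /2⌋ ≡ n
half-1+double zero = refl
half-1+double (suc n) = cong suc (half-1+double n)

odd-digit : ∀ b y → odd (bit b + double y) ≡ b
odd-digit false = odd-double
odd-digit true = odd-1+double

half-digit : ∀ b y → ⌊ bit b + double y /2⌋ ≡ y
half-digit false = half-double
half-digit true = half-1+double

half-< : ∀ {x m} → x < double m → ⌊ x /2⌋ < m
half-< {zero} {suc m} _ = z<s
half-< {suc zero} {suc m} _ = z<s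
half-< {suc (suc x)} {suc m} (s≤s (s≤s x<2m)) = s<s (half-< x<2m)

digit-< : ∀ b {y m} → y < m → bit b + double y < double m
digit-< false {zero} {suc m} _ = z<s
digit-< true {zero} {suc m} _ = s<s z<s
digit-< b {suc y} {suc m} (s≤s y<m) = begin-strict
  bit b + suc (suc (double y)) ≡⟨ +-suc (bit b) _ ⟩
  suc (bit b + suc (double y)) ≡⟨ cong suc (+-suc (bit b) _) ⟩
  suc (suc (bit b + double y)) <⟨ s<s (s<s (digit-< b y<m)) ⟩
  suc (suc (double m))         ∎
  where open ≤-Reasoning

double-< : ∀ {c q} → c < q → double c < double q
double-< = digit-< false

dec : ∀ k → ℕ → BitVec k
dec zero x = []
dec (suc k) x = odd x ∷ dec k ⌊ x /2⌋

enc : ∀ {k} → BitVec k → ℕ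
enc [] = 0
enc (b ∷ v) = bit b + double (enc v)

dec-enc : ∀ {k} (v : BitVec k) → dec k (enc v) ≡ v
dec-enc [] = refl
dec-enc (b ∷ v) = cong₂ _∷_ (odd-digit b (enc v))
  (trans (cong (dec _) (half-digit b (enc v))) (dec-enc v))

enc-< : ∀ {k} (v : BitVec k) → enc v < 2 ^ k
enc-< [] = z<s
enc-< {suc k} (b ∷ v) rewrite 2^suc≡double k = digit-< b (enc-< v)

enc-dec : ∀ k {x} → x < 2 ^ k → enc (dec k x) ≡ x
enc-dec zero {zero} _ = refl
enc-dec zero {suc x} (s≤s ())
enc-dec (suc k) {x} x<2^k+1 = begin
  bit (odd x) + double (enc (dec k ⌊ x /2⌋)) ≡⟨ cong (λ y → bit (odd x) + double y) (enc-dec k half<) ⟩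
  bit (odd x) + double ⌊ x /2⌋               ≡⟨ digit-decomposition x ⟩
  x                                          ∎
  where
  open ≡-Reasoning
  half< : ⌊ x /2⌋ < 2 ^ k
  half< = half-< (subst (x <_) (2^suc≡double k) x<2^k+1)

enc-injective : ∀ {k} (u v : BitVec k) → enc u ≡ enc v → u ≡ v
enc-injective u v eq = trans (sym (dec-enc u)) (trans (cong (dec _) eq) (dec-enc v))

⨁< : ∀ {k} (n : ℕ) → (ℕ → BitVec k) → BitVec k
⨁< n g = ⨁ (λ (i : Fin n) → g (toℕ i))

⨁<-cong : ∀ {k} n {g h : ℕ → BitVec k} → (∀ x → g x ≡ h x) → ⨁< n g ≡ ⨁< n h
⨁<-cong n g≗h = sum-cong-≗ {n = n} (λ i → g≗h (toℕ i))

⨁<-pairs : ∀ {k} n (g : ℕ → BitVec k) →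
           ⨁< (double n) g ≡ ⨁< n (λ x → g (double x) ⊕ g (suc (double x)))
⨁<-pairs zero g = refl
⨁<-pairs (suc n) g = begin
  g 0 ⊕ (g 1 ⊕ ⨁< (double n) (g ∘ suc ∘ suc))
    ≡⟨ sym (⊕-assoc (g 0) (g 1) _) ⟩
  g 0 ⊕ g 1 ⊕ ⨁< (double n) (g ∘ suc ∘ suc)
    ≡⟨ cong (g 0 ⊕ g 1 ⊕_) (⨁<-pairs n (g ∘ suc ∘ suc)) ⟩
  g 0 ⊕ g 1 ⊕ ⨁< n (λ x → g (suc (suc (double x))) ⊕ g (suc (suc (suc (double x))))) ∎
  where open ≡-Reasoning

⨁<-double-const : ∀ {k} n (c : BitVec k) → ⨁< (double n) (λ _ → c) ≡ 𝟎
⨁<-double-const n c = begin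
  ⨁< (double n) (λ _ → c) ≡⟨ ⨁<-pairs n (λ _ → c) ⟩
  ⨁< n (λ _ → c ⊕ c)      ≡⟨ ⨁<-cong n (λ _ → ⊕-self c) ⟩
  ⨁< n (λ _ → 𝟎)          ≡⟨ sum-replicate-zero n ⟩
  𝟎                       ∎
  where open ≡-Reasoning

dec-pair : ∀ k x → dec (suc k) (double x) ⊕ dec (suc k) (suc (double x)) ≡ true ∷ 𝟎
dec-pair k x rewrite odd-double x | odd-1+double x | half-double x | half-1+double x =
  cong (true ∷_) (⊕-self (dec k x))

-- The sum of all vectors of 𝔽₂ᵏ is zero as soon as k ≥ 2: pairing 2x with
-- 2x+1 leaves 2ᵏ⁻¹ copies of (1,0,…,0), an even number.
⨁-allVectors : ∀ k → 2 ≤ k → ⨁< (2 ^ k) (dec k) ≡ 𝟎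
⨁-allVectors (suc (suc j)) (s≤s (s≤s z≤n)) = begin
  ⨁< (2 ^ suc k) (dec (suc k))
    ≡⟨ cong (λ n → ⨁< n (dec (suc k))) (2^suc≡double k) ⟩
  ⨁< (double (2 ^ k)) (dec (suc k))
    ≡⟨ ⨁<-pairs (2 ^ k) (dec (suc k)) ⟩
  ⨁< (2 ^ k) (λ x → dec (suc k) (double x) ⊕ dec (suc k) (suc (double x)))
    ≡⟨ ⨁<-cong (2 ^ k) (dec-pair k) ⟩
  ⨁< (2 ^ k) (λ _ → true ∷ 𝟎)
    ≡⟨ cong (λ n → ⨁< n (λ _ → true ∷ 𝟎)) (2^suc≡double j) ⟩
  ⨁< (double (2 ^ j)) (λ _ → true ∷ 𝟎)
    ≡⟨ ⨁<-double-const (2 ^ j) (true ∷ 𝟎) ⟩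
  𝟎 ∎
  where
  open ≡-Reasoning
  k = suc j

injective⇒surjective : ∀ {n} (f : Fin n → Fin n) → Injective _≡_ _≡_ f →
                       ∀ y → ∃ λ x → f x ≡ y
injective⇒surjective {suc n} f f-inj y with any? (λ x → f x Fin.≟ y)
... | yes hit = hit
... | no miss = contradiction (injective⇒≤ g-inj) 1+n≰n
  where
  -- if y were missed, f would squeeze Fin (n+1) injectively into Fin n
  f≢y : ∀ x → y ≢ f x
  f≢y x y≡fx = miss (x , sym y≡fx)
  g : Fin (suc n) → Fin n
  g x = Fin.punchOut (f≢y x)
  g-inj : Injective _≡_ _≡_ g
  g-inj eq = f-inj (punchOut-injective (f≢y _) (f≢y _) eq)

injective⇒permutation : ∀ {n} (f : Fin n → Fin n) → Injective _≡_ _≡_ f → Permutation n n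
injective⇒permutation f f-inj = permutation f
  (λ y → proj₁ (injective⇒surjective f f-inj y))
  (λ y → proj₂ (injective⇒surjective f f-inj y))
  (λ x → f-inj (proj₂ (injective⇒surjective f f-inj (f x))))

-- If 2ᵏ vectors of 𝔽₂ᵏ (k ≥ 2) have pairwise distinct codes, they are all of
-- 𝔽₂ᵏ in some order, so they sum to zero.
distinctCodes⇒⨁≡𝟎 : ∀ k → 2 ≤ k → (w : Fin (2 ^ k) → BitVec k) →
                    (∀ e e' → e ≢ e' → enc (w e) ≢ enc (w e')) → ⨁ w ≡ 𝟎
distinctCodes⇒⨁≡𝟎 k 2≤k w distinct = begin
  ⨁ w                                  ≡⟨ sum-cong-≗ w≡dec∘σ ⟩
  ⨁ (λ e → dec k (toℕ (σ e)))          ≡⟨ sym (∑-permute (dec k ∘ toℕ) (injective⇒permutation σ σ-inj)) ⟩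
  ⨁< (2 ^ k) (dec k)                   ≡⟨ ⨁-allVectors k 2≤k ⟩
  𝟎                                    ∎
  where
  open ≡-Reasoning
  σ : Fin (2 ^ k) → Fin (2 ^ k)
  σ e = fromℕ< (enc-< (w e))
  σ-inj : Injective _≡_ _≡_ σ
  σ-inj {e} {e'} σe≡σe' with e Fin.≟ e'
  ... | yes e≡e' = e≡e'
  ... | no e≢e' = contradiction
    (trans (sym (toℕ-fromℕ< _)) (trans (cong toℕ σe≡σe') (toℕ-fromℕ< _)))
    (distinct e e' e≢e')
  w≡dec∘σ : ∀ e → w e ≡ dec k (toℕ (σ e))
  w≡dec∘σ e = sym (trans (cong (dec k) (toℕ-fromℕ< _)) (dec-enc (w e)))

⨁-telescope : ∀ {k} m (u : Fin (suc m) → BitVec k) →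
              ⨁ (λ e → u (inject₁ e) ⊕ u (Fin.suc e)) ≡ u Fin.zero ⊕ u (fromℕ m)
⨁-telescope zero u = sym (⊕-self (u Fin.zero))
⨁-telescope (suc m) u = begin
  u₀ ⊕ u₁ ⊕ ⨁ (λ e → u (Fin.suc (inject₁ e)) ⊕ u (Fin.suc (Fin.suc e)))
    ≡⟨ cong (u₀ ⊕ u₁ ⊕_) (⨁-telescope m (u ∘ Fin.suc)) ⟩
  u₀ ⊕ u₁ ⊕ (u₁ ⊕ u (fromℕ (suc m)))
    ≡⟨ ⊕-telescope u₀ u₁ _ ⟩
  u₀ ⊕ u (fromℕ (suc m)) ∎
  where
  open ≡-Reasoning
  u₀ = u Fin.zero
  u₁ = u (Fin.suc Fin.zero)

-- partner a is the other member of the pair {2c, 2c+1} containing a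
partner : ℕ → ℕ
partner zero = 1
partner (suc zero) = 0
partner (suc (suc a)) = suc (suc (partner a))

partner-involutive : ∀ a → partner (partner a) ≡ a
partner-involutive zero = refl
partner-involutive (suc zero) = refl
partner-involutive (suc (suc a)) = cong (suc ∘ suc) (partner-involutive a)

partner-double : ∀ c → partner (double c) ≡ suc (double c)
partner-double zero = refl
partner-double (suc c) = cong (suc ∘ suc) (partner-double c)

partner-< : ∀ {a} q → a < double q → partner a < double q
partner-< {zero} (suc q) _ = s<s z<s
partner-< {suc zero} (suc q) _ = z<s
partner-< {suc (suc a)} (suc q) (s≤s (s≤s a<2q)) = s<s (s<s (partner-< q a<2q))

partner-irreflexive : ∀ a → partner a ≢ a
partner-irreflexive (suc (suc a)) eq = partner-irreflexive a (suc-injective (suc-injective eq))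

evenWalk-returns : ∀ h {m} → m ≡ double h → (b : Fin (suc m) → ℕ) →
                   (∀ e → b (Fin.suc e) ≡ partner (b (inject₁ e))) → b Fin.zero ≡ b (fromℕ m)
evenWalk-returns zero refl b _ = refl
evenWalk-returns (suc h) refl b step = begin
  b₀                   ≡⟨ sym (partner-involutive b₀) ⟩
  partner (partner b₀) ≡⟨ cong partner (sym (step Fin.zero)) ⟩
  partner (b₁)         ≡⟨ sym (step (Fin.suc Fin.zero)) ⟩
  b (Fin.suc (Fin.suc Fin.zero))
    ≡⟨ evenWalk-returns h refl (b ∘ Fin.suc ∘ Fin.suc) (step ∘ Fin.suc ∘ Fin.suc) ⟩
  b (fromℕ (double (suc h))) ∎
  where
  open ≡-Reasoning
  b₀ = b Fin.zero
  b₁ = b (Fin.suc Fin.zero)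

2^-even : ∀ {k} → 1 ≤ k → 2 ^ k ≡ double (2 ^ pred k)
2^-even {suc k} _ = 2^suc≡double k

module Colouring (k : ℕ) where

  P : ℕ
  P = 2 ^ k

  instance
    P-nonZero : NonZero P
    P-nonZero = m^n≢0 2 k

  block : ℕ → ℕ
  block x = x / P

  label : ℕ → BitVec k
  label x = dec k (x % P)

  label-block-injective : ∀ x y → label x ≡ label y → block x ≡ block y → x ≡ y
  label-block-injective x y same-label same-block = begin
    x                 ≡⟨ m≡m%n+[m/n]*n x P ⟩
    x % P + x / P * P ≡⟨ cong₂ (λ r b → r + b * P) same-offset same-block ⟩
    y % P + y / P * P ≡⟨ sym (m≡m%n+[m/n]*n y P) ⟩
    y                 ∎
    where
    open ≡-Reasoning
    same-offset : x % P ≡ y % P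
    same-offset = trans (sym (enc-dec k (m%n<n x P)))
                        (trans (cong enc same-label) (enc-dec k (m%n<n y P)))

  colouring : ∀ {N} → EdgeColoring N
  colouring i j = enc (label (toℕ i) ⊕ label (toℕ j))

  PartnerGraph : ∀ {N} → Graph N → Set
  PartnerGraph G = ∀ i j → Edge G i j → block (toℕ j) ≡ partner (block (toℕ i))

  -- Two neighbours of u lie in the same block (the partner of u's block), and
  -- equal colours force equal labels, so they coincide.
  colouring-proper : ∀ {N} (G : Graph N) → PartnerGraph G → IsProperColoring G colouring
  colouring-proper G partners = symmetric , neighbours-distinguished
    where
    symmetric : ∀ i j → Edge G i j → colouring i j ≡ colouring j i
    symmetric i j _ = cong enc (⊕-comm (label (toℕ i)) (label (toℕ j)))
    neighbours-distinguished : ∀ u v w → Edge G u v → Edge G u w → v ≢ w →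
                               colouring u v ≢ colouring u w
    neighbours-distinguished u v w uv uw v≢w same-colour =
      v≢w (toℕ-injective (label-block-injective (toℕ v) (toℕ w) same-label same-block))
      where
      same-label : label (toℕ v) ≡ label (toℕ w)
      same-label = ⊕-cancelˡ (label (toℕ u)) _ _ (enc-injective _ _ same-colour)
      same-block : block (toℕ v) ≡ block (toℕ w)
      same-block = trans (partners u v uv) (sym (partners u w uw))

  -- A rainbow path with 2ᵏ edges uses every colour once, so its edge labels
  -- sum to zero and (telescoping) its ends have equal labels; having even
  -- length, it also ends in the block where it started.  Hence its ends
  -- coincide, contradicting that a path has distinct vertices.
  colouring-noRainbow : 2 ≤ k → ∀ {N} (G : Graph N) → PartnerGraph G →
                        NoRainbowPath G colouring (2 ^ k)
  colouring-noRainbow 2≤k G partners (path , rainbow) =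
    <-irrefl (trans (cong toℕ (distinct path ends-equal)) (toℕ-fromℕ P)) (m^n>0 2 k)
    where
    u : Fin (suc P) → Fin _
    u = vtx path
    ℓ : Fin (suc P) → BitVec k
    ℓ i = label (toℕ (u i))
    same-label : ℓ Fin.zero ≡ ℓ (fromℕ P)
    same-label = ⊕≡𝟎⇒≡ _ _ (begin
      ℓ Fin.zero ⊕ ℓ (fromℕ P)                    ≡⟨ sym (⨁-telescope P ℓ) ⟩
      ⨁ (λ e → ℓ (inject₁ e) ⊕ ℓ (Fin.suc e))     ≡⟨ distinctCodes⇒⨁≡𝟎 k 2≤k _ rainbow ⟩
      𝟎                                           ∎)
      where open ≡-Reasoning
    same-block : block (toℕ (u Fin.zero)) ≡ block (toℕ (u (fromℕ P)))
    same-block = evenWalk-returns _ (2^-even (≤-trans (s≤s z≤n) 2≤k)) (block ∘ toℕ ∘ u)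
                   (λ e → partners _ _ (edges path e))
    ends-equal : u Fin.zero ≡ u (fromℕ P)
    ends-equal = toℕ-injective (label-block-injective _ _ same-label same-block)

Σ< : ℕ → (ℕ → ℕ) → ℕ
Σ< zero H = 0
Σ< (suc n) H = H 0 + Σ< n (H ∘ suc)

listSum≡Σ< : ∀ n (H : ℕ → ℕ) → listSum (map (λ i → H (toℕ i)) (allFin n)) ≡ Σ< n H
listSum≡Σ< n H = trans (cong listSum (map-tabulate {n = n} id (H ∘ toℕ))) (tabulated n H)
  where
  tabulated : ∀ n (H : ℕ → ℕ) → listSum (tabulate {n = n} (H ∘ toℕ)) ≡ Σ< n H
  tabulated zero H = refl
  tabulated (suc n) H = cong (H 0 +_) (tabulated n (H ∘ suc))

Σ<-cong : ∀ n {G H : ℕ → ℕ} → (∀ x → G x ≡ H x) → Σ< n G ≡ Σ< n H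
Σ<-cong zero G≗H = refl
Σ<-cong (suc n) G≗H = cong₂ _+_ (G≗H 0) (Σ<-cong n (G≗H ∘ suc))

Σ<-split : ∀ a b (H : ℕ → ℕ) → Σ< (a + b) H ≡ Σ< a H + Σ< b (λ x → H (a + x))
Σ<-split zero b H = refl
Σ<-split (suc a) b H = trans (cong (H 0 +_) (Σ<-split a b (H ∘ suc))) (sym (+-assoc (H 0) _ _))

Σ<-blocks : ∀ q L (H : ℕ → ℕ) → Σ< (q * L) H ≡ Σ< q (λ c → Σ< L (λ t → H (c * L + t)))
Σ<-blocks zero L H = refl
Σ<-blocks (suc q) L H = begin
  Σ< (L + q * L) H
    ≡⟨ Σ<-split L (q * L) H ⟩
  Σ< L H + Σ< (q * L) (λ x → H (L + x))
    ≡⟨ cong (Σ< L H +_) (Σ<-blocks q L (λ x → H (L + x))) ⟩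
  Σ< L H + Σ< q (λ c → Σ< L (λ t → H (L + (c * L + t))))
    ≡⟨ cong (Σ< L H +_) (Σ<-cong q (λ c → Σ<-cong L (λ t → cong H (sym (+-assoc L (c * L) t))))) ⟩
  Σ< L H + Σ< q (λ c → Σ< L (λ t → H (suc c * L + t))) ∎
  where open ≡-Reasoning

Σ<-window : ∀ a L n (H : ℕ → ℕ) → a + L ≤ n → Σ< L (λ x → H (a + x)) ≤ Σ< n H
Σ<-window a L n H a+L≤n = begin
  Σ< L (λ x → H (a + x))                                    ≤⟨ m≤n+m _ (Σ< a H) ⟩
  Σ< a H + Σ< L (λ x → H (a + x))                           ≡⟨ sym (Σ<-split a L H) ⟩
  Σ< (a + L) H                                              ≤⟨ m≤m+n _ _ ⟩
  Σ< (a + L) H + Σ< (n ∸ (a + L)) (λ x → H (a + L + x))     ≡⟨ sym (Σ<-split (a + L) _ H) ⟩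
  Σ< (a + L + (n ∸ (a + L))) H                              ≡⟨ cong (λ m → Σ< m H) (m+[n∸m]≡n a+L≤n) ⟩
  Σ< n H                                                    ∎
  where open ≤-Reasoning

Σ<-lower : ∀ m c (H : ℕ → ℕ) → (∀ t → t < m → c ≤ H t) → m * c ≤ Σ< m H
Σ<-lower zero c H _ = z≤n
Σ<-lower (suc m) c H c≤H =
  +-mono-≤ (c≤H 0 (s≤s z≤n)) (Σ<-lower m c (H ∘ suc) (λ t t<m → c≤H (suc t) (s≤s t<m)))

T-ext : ∀ {x y} → (T x → T y) → (T y → T x) → x ≡ y
T-ext {false} {false} _ _ = refl
T-ext {false} {true} _ y⇒x = ⊥-elim (y⇒x tt)
T-ext {true} {false} x⇒y _ = ⊥-elim (x⇒y tt)
T-ext {true} {true} _ _ = refl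

-- Adjacency between blocks for q disjoint copies of K_{P,P}: block a < 2q is
-- joined to its partner block.
pairedAdj : ℕ → ℕ → ℕ → Bool
pairedAdj q a b = (a <ᵇ double q) ∧ (b ≡ᵇ partner a)

pairedAdj⇒ : ∀ q a b → T (pairedAdj q a b) → a < double q × b ≡ partner a
pairedAdj⇒ q a b adj with Equivalence.to T-∧ adj
... | a<2q , b≡a′ = <ᵇ⇒< a (double q) a<2q , ≡ᵇ⇒≡ b (partner a) b≡a′

⇒pairedAdj : ∀ q a b → a < double q → b ≡ partner a → T (pairedAdj q a b)
⇒pairedAdj q a b a<2q b≡a′ = Equivalence.from T-∧ (<⇒<ᵇ a<2q , ≡⇒≡ᵇ b (partner a) b≡a′)

pairedAdj-swap : ∀ q a b → T (pairedAdj q a b) → T (pairedAdj q b a)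
pairedAdj-swap q a b adj with pairedAdj⇒ q a b adj
... | a<2q , refl = ⇒pairedAdj q (partner a) a (partner-< q a<2q) (sym (partner-involutive a))

pairedAdj-sym : ∀ q a b → pairedAdj q a b ≡ pairedAdj q b a
pairedAdj-sym q a b = T-ext (pairedAdj-swap q a b) (pairedAdj-swap q b a)

pairedAdj-irrefl : ∀ q a → pairedAdj q a a ≡ false
pairedAdj-irrefl q a =
  T-ext (λ adj → partner-irreflexive a (sym (proj₂ (pairedAdj⇒ q a a adj)))) λ ()

module Hosts (k : ℕ) where
  open Colouring k

  block-of : ∀ b {t} → t < P → block (b * P + t) ≡ b
  block-of b {t} t<P = begin
    (b * P + t) / P     ≡⟨ +-distrib-/-∣ˡ t (n∣m*n b) ⟩
    b * P / P + t / P   ≡⟨ cong₂ _+_ (m*n/n≡m b P) (m<n⇒m/n≡0 t<P) ⟩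
    b + 0               ≡⟨ +-identityʳ b ⟩
    b                   ∎
    where open ≡-Reasoning

  block-side : ∀ x → x < P + P → block x ≡ (if x <ᵇ P then 0 else 1)
  block-side x x<2P with x <ᵇ P | <ᵇ-reflects-< x P
  ... | true  | ofʸ x<P = m<n⇒m/n≡0 x<P
  ... | false | ofⁿ x≮P =
    trans (m/n≡1+[m∸n]/n (≮⇒≥ x≮P)) (cong suc (m<n⇒m/n≡0 (m<n+o⇒m∸n<o x P x<2P)))

  completeBipartite-partners : PartnerGraph (completeBipartite P P)
  completeBipartite-partners i j edge
    rewrite block-side (toℕ i) (toℕ<n i) | block-side (toℕ j) (toℕ<n j)
    with toℕ i <ᵇ P | toℕ j <ᵇ P
  completeBipartite-partners i j ()   | true  | true
  completeBipartite-partners i j edge | true  | false = refl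
  completeBipartite-partners i j edge | false | true  = refl
  completeBipartite-partners i j ()   | false | false

  -- q disjoint copies of K_{P,P} on Fin n: blocks 2c and 2c+1 are completely
  -- joined for every c < q, all other vertices are isolated
  pairedBlocks : (n q : ℕ) → Graph n
  pairedBlocks n q = record
    { adj = λ i j → pairedAdj q (block (toℕ i)) (block (toℕ j))
    ; sym = λ i j → pairedAdj-sym q _ _
    ; irrefl = λ i → pairedAdj-irrefl q _
    }

  pairedBlocks-partners : ∀ n q → PartnerGraph (pairedBlocks n q)
  pairedBlocks-partners n q i j edge = proj₂ (pairedAdj⇒ q _ _ (Equivalence.from T-≡ edge))

  pair-offset : ∀ c → c * (P + P) ≡ double c * P
  pair-offset c = begin
    c * (P + P)     ≡⟨ *-distribˡ-+ c P P ⟩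
    c * P + c * P   ≡⟨ sym (*-distribʳ-+ P c c) ⟩
    (c + c) * P     ≡⟨ cong (_* P) (sym (double≡+ c)) ⟩
    double c * P    ∎
    where open ≡-Reasoning

  module Count (n q : ℕ) (pairs-fit : q * (P + P) ≤ n) where
    E : ℕ → ℕ → ℕ
    E x y = if pairedAdj q (block x) (block y) ∧ (x <ᵇ y) then 1 else 0

    row : ℕ → ℕ
    row x = Σ< n (E x)

    edgeCount≡ : edgeCount (pairedBlocks n q) ≡ Σ< n row
    edgeCount≡ = trans (listSum≡Σ< n _) (Σ<-cong n (λ x → listSum≡Σ< n (E x)))

    indicator-true : ∀ {b} → T b → 1 ≤ (if b then 1 else 0)
    indicator-true {true} _ = s≤s z≤n

    cross-edge : ∀ c {t u} → c < q → t < P → u < P →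
                 1 ≤ E (double c * P + t) (suc (double c) * P + u)
    cross-edge c {t} {u} c<q t<P u<P =
      indicator-true (Equivalence.from T-∧ (adjacent , <⇒<ᵇ x<y))
      where
      x y : ℕ
      x = double c * P + t
      y = suc (double c) * P + u
      adjacent : T (pairedAdj q (block x) (block y))
      adjacent rewrite block-of (double c) t<P | block-of (suc (double c)) u<P =
        ⇒pairedAdj q _ _ (double-< c<q) (sym (partner-double c))
      x<y : x < y
      x<y = begin-strict
        double c * P + t       <⟨ +-monoʳ-< (double c * P) t<P ⟩
        double c * P + P       ≡⟨ +-comm (double c * P) P ⟩
        P + double c * P       ≤⟨ m≤m+n _ u ⟩
        y                      ∎
        where open ≤-Reasoning

    row-lower : ∀ c {t} → c < q → t < P → P ≤ row (double c * P + t)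
    row-lower c {t} c<q t<P = begin
      P                                                  ≡⟨ sym (*-identityʳ P) ⟩
      P * 1                                              ≤⟨ Σ<-lower P 1 _ (λ u u<P → cross-edge c c<q t<P u<P) ⟩
      Σ< P (λ u → E (double c * P + t) (suc (double c) * P + u)) ≤⟨ Σ<-window _ P n _ next-pair-fits ⟩
      row (double c * P + t)                             ∎
      where
      open ≤-Reasoning
      next-pair-fits : suc (double c) * P + P ≤ n
      next-pair-fits = begin
        suc (double c) * P + P  ≡⟨ +-comm (suc (double c) * P) P ⟩
        double (suc c) * P      ≡⟨ sym (pair-offset (suc c)) ⟩
        suc c * (P + P)         ≤⟨ *-monoˡ-≤ (P + P) c<q ⟩
        q * (P + P)             ≤⟨ pairs-fit ⟩
        n                       ∎

    -- the first block of each of the q pairs contributes P rows of weight ≥ P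
    edgeCount-lower : P * P * q ≤ edgeCount (pairedBlocks n q)
    edgeCount-lower = begin
      P * P * q                                                 ≡⟨ *-comm (P * P) q ⟩
      q * (P * P)                                               ≤⟨ Σ<-lower q (P * P) _ pair-lower ⟩
      Σ< q (λ c → Σ< (P + P) (λ t → row (c * (P + P) + t)))     ≡⟨ sym (Σ<-blocks q (P + P) row) ⟩
      Σ< (q * (P + P)) row                                      ≤⟨ Σ<-window 0 _ n row pairs-fit ⟩
      Σ< n row                                                  ≡⟨ sym edgeCount≡ ⟩
      edgeCount (pairedBlocks n q)                              ∎
      where
      open ≤-Reasoning
      pair-lower : ∀ c → c < q → P * P ≤ Σ< (P + P) (λ t → row (c * (P + P) + t))
      pair-lower c c<q = begin
        P * P                                      ≤⟨ Σ<-lower P P _ first-block-rows ⟩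
        Σ< P (λ t → row (c * (P + P) + t))         ≤⟨ Σ<-window 0 P (P + P) _ (m≤m+n P P) ⟩
        Σ< (P + P) (λ t → row (c * (P + P) + t))   ∎
        where
        first-block-rows : ∀ t → t < P → P ≤ row (c * (P + P) + t)
        first-block-rows t t<P =
          subst (λ z → P ≤ row (z + t)) (sym (pair-offset c)) (row-lower c c<q t<P)

  completeBipartite-noRainbow : 2 ≤ k →
    ∃[ c ] (IsProperColoring (completeBipartite P P) c × NoRainbowPath (completeBipartite P P) c P)
  completeBipartite-noRainbow 2≤k =
    colouring , colouring-proper K completeBipartite-partners ,
    colouring-noRainbow 2≤k K completeBipartite-partners
    where K = completeBipartite P P

  exStar-lower : 2 ≤ k → ∀ n q → q * (P + P) ≤ n → exStarPathAtLeast n P (P * P * q)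
  exStar-lower 2≤k n q pairs-fit =
    G , Count.edgeCount-lower n q pairs-fit , colouring ,
    colouring-proper G (pairedBlocks-partners n q) , colouring-noRainbow 2≤k G (pairedBlocks-partners n q)
    where G = pairedBlocks n q

-- the statement measures pairs of blocks by 2^{k+1}
2^[k+1]≡2^k+2^k : ∀ k → 2 ^ (k + 1) ≡ 2 ^ k + 2 ^ k
2^[k+1]≡2^k+2^k k = trans (cong (2 ^_) (+-comm k 1)) (trans (2^suc≡double k) (double≡+ (2 ^ k)))

mainTheorem2 : ∀ (k : ℕ) → 2 ≤ k →
    (∃[ c ] (IsProperColoring (completeBipartite (2 ^ k) (2 ^ k)) c
             × NoRainbowPath (completeBipartite (2 ^ k) (2 ^ k)) c (2 ^ k)))
    × (∀ (n : ℕ) → exStarPathAtLeast n (2 ^ k) ((2 ^ k) * (2 ^ k) * (_/_ n (2 ^ (k + 1)) {{m^n≢0 2 (k + 1)}})))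
mainTheorem2 k 2≤k = completeBipartite-noRainbow 2≤k , λ n → exStar-lower 2≤k n _ (pairs-fit n)
  where
  open Hosts k
  pairs-fit : ∀ n → _/_ n (2 ^ (k + 1)) {{m^n≢0 2 (k + 1)}} * (2 ^ k + 2 ^ k) ≤ n
  pairs-fit n = subst (λ d → _/_ n (2 ^ (k + 1)) {{m^n≢0 2 (k + 1)}} * d ≤ n) (2^[k+1]≡2^k+2^k k)
                      (m/n*n≤m n (2 ^ (k + 1)) {{m^n≢0 2 (k + 1)}})
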